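{- Let $(G,k)$ be an instance of Paw-free Edge Deletion, and let $M$ be the set of all vertices of the paws in a maximal family of pairwise edge-disjoint induced paws of $G$. Let $\mathcal C$ be the set of type II triangle-free components of $G-M$ and $U=\bigcup_{C\in\mathcal C}V(C)$. Mark vertices of $U$ as follows: (i) for each $S\subseteq M$ with $|S|=3$ and each $S'\subseteq S$, mark $k+1$ vertices of $\{x\in U: N(x)\cap S=S'\}$ (all of them if there are fewer); (ii) for each nontrivial $C\in\mathcal C$ and each vertex $x\in V(C)$ that lies in a triangle of $G$ together with two vertices of $M$, mark $x$ and mark $k+1$ of its neighbors in $C$ (all of them if there are fewer). Let $G^*$ be obtained from $G$ by deleting all unmarked vertices of $U$. Then $(G,k)$ is a yes-instance if and only if $(G^*,k)$ is a yes-instance.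
   Context: All graphs are finite, simple and undirected. A paw is the four-vertex graph consisting of a triangle together with one additional vertex adjacent to exactly one vertex of the triangle; a graph is paw-free if it has no induced paw. Paw-free Edge Deletion: given a graph $G$ and an integer $k\ge 0$, decide whether there is $E_-\subseteq E(G)$ with $|E_-|\le k$ such that $G-E_-$ is paw-free. A family of induced paws is pairwise edge-disjoint if no edge of $G$ belongs to two of them; it is maximal if no further induced paw of $G$ can be added. A triangle-free component $C$ of $G-M$ (a connected component of $G-M$ containing no triangle) is of type I if there are a vertex $v\in M$ and an edge $uw$ of $C$ with $v$ adjacent to both $u$ and $w$, and of type II otherwise. A component is trivial if it consists of a single vertex. $N(x)$ denotes the neighborhood of $x$ in $G$. -}

module Defs where

open import Data.Nat using (ℕ; suc; _≤_)
open import Data.Fin using (Fin)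
open import Data.Fin.Subset using (Subset; _⊆_; ∣_∣) renaming (_∈_ to _∈ₛ_)
open import Data.List using (List; length; lookup)
open import Data.List.Membership.Propositional using (_∈_)
open import Data.List.Relation.Unary.All using (All)
open import Data.List.Relation.Unary.Unique.Propositional using (Unique)
open import Data.Product using (Σ; ∃; ∃-syntax; _×_; _,_; proj₁; proj₂)
open import Data.Sum using (_⊎_)
open import Relation.Nullary using (¬_)
open import Relation.Binary using (Decidable)
open import Relation.Binary.PropositionalEquality using (_≡_; _≢_)
open import Function.Bundles using (_⇔_)

record Graph (V : Set) : Set₁ where
  field
    Adj    : V → V → Set
    sym    : ∀ {x y} → Adj x y → Adj y x
    irrefl : ∀ {x} → ¬ Adj x x
    adj?   : Decidable Adj
open Graph public

IsInducedPaw : {V : Set} → (V → V → Set) → V → V → V → V → Set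
IsInducedPaw R a b c d =
  R a b × R b c × R a c × R c d × ¬ R a d × ¬ R b d

PawFree : {V : Set} → (V → V → Set) → Set
PawFree {V} R = ∀ (a b c d : V) → ¬ IsInducedPaw R a b c d

DeleteEdges : {V : Set} → Graph V → List (V × V) → V → V → Set
DeleteEdges G L x y = Adj G x y × ¬ ((x , y) ∈ L) × ¬ ((y , x) ∈ L)

YesInstance : {V : Set} → Graph V → ℕ → Set
YesInstance {V} G k =
  ∃[ L ] (All (λ e → Adj G (proj₁ e) (proj₂ e)) L × length L ≤ k
          × PawFree (DeleteEdges G L))

Induced : ∀ {n} → Graph (Fin n) → (K : Subset n) → Graph (Σ (Fin n) (_∈ₛ K))
Induced G K = record
  { Adj    = λ x y → Adj G (proj₁ x) (proj₁ y)
  ; sym    = sym G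
  ; irrefl = irrefl G
  ; adj?   = λ x y → adj? G (proj₁ x) (proj₁ y)
  }

module Setting {n : ℕ} (G : Graph (Fin n)) where

  V = Fin n

  record Paw : Set where
    constructor paw
    field
      a b c d : V
      isPaw   : IsInducedPaw (Adj G) a b c d
  open Paw public

  PawEdge : Paw → V → V → Set
  PawEdge P x y =
    let E : V → V → Set
        E u v = (x ≡ u × y ≡ v) ⊎ (x ≡ v × y ≡ u)
    in E (a P) (b P) ⊎ E (b P) (c P) ⊎ E (a P) (c P) ⊎ E (c P) (d P)

  PawVertex : Paw → V → Set
  PawVertex P x = x ≡ a P ⊎ x ≡ b P ⊎ x ≡ c P ⊎ x ≡ d P

  EdgeDisjoint : List Paw → Set
  EdgeDisjoint F = ∀ (i j : Fin (length F)) → i ≢ j →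
    ∀ x y → PawEdge (lookup F i) x y → ¬ PawEdge (lookup F j) x y

  -- maximal: no induced paw of G can be added keeping edge-disjointness
  Maximal : List Paw → Set
  Maximal F = ∀ (P : Paw) → ∃[ i ] ∃[ x ] ∃[ y ]
    (PawEdge (lookup F i) x y × PawEdge P x y)

  module Family (F : List Paw) where

    InM : V → Set
    InM x = ∃[ i ] PawVertex (lookup F i) x

    -- y is in the connected component of x in G - M (x, y ∉ M)
    data Reach : V → V → Set where
      here : ∀ {x} → ¬ InM x → Reach x x
      step : ∀ {x y z} → ¬ InM x → Adj G x y → Reach y z → Reach x z

    TriangleFreeComp : V → Set
    TriangleFreeComp x = ¬ (∃[ u ] ∃[ v ] ∃[ w ]
      (Reach x u × Reach x v × Reach x w
       × Adj G u v × Adj G v w × Adj G u w))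

    TypeIComp : V → Set
    TypeIComp x = ∃[ v ] ∃[ u ] ∃[ w ]
      (InM v × Reach x u × Reach x w × Adj G u w × Adj G v u × Adj G v w)

    InU : V → Set
    InU x = ¬ InM x × TriangleFreeComp x × ¬ TypeIComp x

    Nontrivial : V → Set
    Nontrivial x = ∃[ y ] (y ≢ x × Reach x y)

    MarkChoice : ℕ → (V → Set) → List V → Set
    MarkChoice k X L = Unique L × All X L
      × (length L ≡ suc k ⊎ (∀ x → X x → x ∈ L))

    RuleIPair : Subset n → Subset n → Set
    RuleIPair S S' = ∣ S ∣ ≡ 3 × (∀ y → y ∈ₛ S → InM y) × S' ⊆ S

    ClassI : Subset n → Subset n → V → Set
    ClassI S S' x = InU x × (∀ y → (Adj G x y × y ∈ₛ S) ⇔ y ∈ₛ S')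

    EligibleII : V → Set
    EligibleII x = InU x × Nontrivial x × ∃[ m₁ ] ∃[ m₂ ]
      (InM m₁ × InM m₂ × Adj G x m₁ × Adj G x m₂ × Adj G m₁ m₂)

    NbrInComp : V → V → Set
    NbrInComp x y = Adj G x y × Reach x y

    -- a run of the marking procedure: the choices made in (i) and (ii)
    record Marking (k : ℕ) : Set where
      field
        chooseI    : Subset n → Subset n → List V
        chooseI-ok : ∀ S S' → RuleIPair S S' →
                     MarkChoice k (ClassI S S') (chooseI S S')
        chooseII    : V → List V
        chooseII-ok : ∀ x → EligibleII x →
                      MarkChoice k (NbrInComp x) (chooseII x)

    Marked : ∀ {k} → Marking k → V → Set
    Marked mk x =
      (∃[ S ] ∃[ S' ] (RuleIPair S S' × x ∈ Marking.chooseI mk S S'))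
      ⊎ EligibleII x
      ⊎ (∃[ z ] (EligibleII z × x ∈ Marking.chooseII mk z))

-- A solution for G restricts to one for the induced subgraph G*. Conversely, a solution L of G*
-- lies inside K, and a paw of G − L using a vertex u ∉ K (so u ∈ U is unmarked) can be moved onto K
-- one vertex at a time. The component of u is triangle-free and of type II, so every triangle
-- through u has its other two vertices in M, and u has no neighbour off M in common with a vertex
-- of M. Hence the role of u in the paw is determined by its adjacency to three vertices of M, and
-- rule (i) marked k + 1 vertices of U with the same adjacency; the exception is a pendant u of a
-- vertex c ∉ M of its component, where c lies in a triangle with two vertices of M and rule (ii)
-- marked k + 1 neighbours of c (u itself, when it is the degree-three vertex of a paw with pendant
-- off M, was marked by rule (ii)). At most k of the k + 1 candidates meet a deleted edge, so one of
-- them can replace u.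

module Submission where

open import Defs
open import Data.Nat using (ℕ; suc; _≤_; _<_; s≤s; z≤n)
open import Data.Nat.Properties using (≤-trans; ≮⇒≥; <⇒≱; m≤n⇒m≤1+n)
open import Data.Fin as Fin using (Fin; zero; suc; _≟_)
open import Data.Fin.Properties using (pigeonhole) renaming (any? to ∃-Fin?)
open import Data.Fin.Subset using (Subset; ⁅_⁆; _∪_; ⊥; ∣_∣; inside; outside)
  renaming (_∈_ to _∈ₛ_; _∉_ to _∉ₛ_)
open import Data.Fin.Subset.Properties
  using (_∈?_; ∉⊥; ∣⊥∣≡0; ∪-identityˡ; x∈⁅x⁆; x∈⁅y⁆⇒x≡y; x∈p∪q⁺; x∈p∪q⁻)
open import Data.Vec using (_∷_; here; there)
open import Data.Vec.Properties.WithK using ([]=-irrelevant)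
open import Data.List using (List; []; _∷_; length; lookup; map; filter; foldr)
open import Data.List.Properties using (length-map)
open import Data.List.Membership.Propositional using (_∈_; _∉_; find; lose)
open import Data.List.Membership.Propositional.Properties
  using (∈-lookup; ∈-map⁺; ∈-map⁻; ∈-filter⁺; ∈-filter⁻)
import Data.List.Membership.DecPropositional as DecMembership
open import Data.List.Relation.Unary.Any using (Any; here; there; index; any?)
open import Data.List.Relation.Unary.Any.Properties using (lookup-index)
open import Data.List.Relation.Unary.All as All using (All; []; _∷_; all?)
open import Data.List.Relation.Unary.All.Properties using (¬All⇒Any¬) renaming (map⁺ to All-map⁺)
open import Data.List.Relation.Unary.AllPairs using ([]; _∷_)
open import Data.List.Relation.Unary.Unique.Propositional using (Unique)
open import Data.Product using (Σ; ∃-syntax; _×_; _,_; proj₁; proj₂)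
open import Data.Product.Properties using (≡-dec)
open import Data.Sum using (_⊎_; inj₁; inj₂)
open import Data.Empty using (⊥-elim)
open import Function using (_∘_)
open import Function.Bundles using (_⇔_; mk⇔; Equivalence)
open import Relation.Nullary using (¬_; yes; no)
open import Relation.Nullary.Decidable using (_⊎-dec_; _×-dec_)
open import Relation.Nullary.Negation using (¬¬-map; contradiction)
open import Relation.Unary using (Decidable)
open import Relation.Binary.Definitions using (DecidableEquality)
open import Relation.Binary.PropositionalEquality using (_≡_; _≢_; refl; trans; cong; subst; ≢-sym)
import Relation.Binary.PropositionalEquality as ≡

open Equivalence using (to; from)

lookup-distinct : ∀ {A : Set} {xs : List A} → Unique xs →
  ∀ {i j : Fin (length xs)} → i Fin.< j → lookup xs i ≢ lookup xs j
lookup-distinct {xs = _ ∷ _} (x≢ ∷ _) {zero} {suc j} _ = All.lookup x≢ (∈-lookup j)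
lookup-distinct {xs = _ ∷ _} (_ ∷ uniq) {suc i} {suc j} (s≤s i<j) = lookup-distinct uniq i<j

module Touching {A : Set} where

  Touches : List (A × A) → List A → A → Set
  Touches E ts x = Any (λ t → (x , t) ∈ E ⊎ (t , x) ∈ E) ts

  ¬touches⇒∉ : ∀ {E ts x t} → ¬ Touches E ts x → t ∈ ts → (x , t) ∉ E × (t , x) ∉ E
  ¬touches⇒∉ ¬touch t∈ = ¬touch ∘ lose t∈ ∘ inj₁ , ¬touch ∘ lose t∈ ∘ inj₂

  private
    JoinedTo : List A → A → A × A → Set
    JoinedTo ts x e = ∃[ t ] t ∈ ts × (e ≡ (x , t) ⊎ e ≡ (t , x))

    joinedTo-unique : ∀ {ts x x' e} → x ∉ ts → x' ∉ ts →
      JoinedTo ts x e → JoinedTo ts x' e → x ≡ x'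
    joinedTo-unique _  _   (_ , _  , inj₁ refl) (_ , _   , inj₁ refl) = refl
    joinedTo-unique _  x'∉ (_ , t∈ , inj₁ refl) (_ , _   , inj₂ refl) = contradiction t∈ x'∉
    joinedTo-unique x∉ _   (_ , _  , inj₂ refl) (_ , t'∈ , inj₁ refl) = contradiction t'∈ x∉
    joinedTo-unique _  _   (_ , _  , inj₂ refl) (_ , _   , inj₂ refl) = refl

    touching-edge : ∀ {E ts x} → Touches E ts x → ∃[ e ] e ∈ E × JoinedTo ts x e
    touching-edge touch with find touch
    ... | t , t∈ , inj₁ e∈ = _ , e∈ , t , t∈ , inj₁ refl
    ... | t , t∈ , inj₂ e∈ = _ , e∈ , t , t∈ , inj₂ refl

  -- Pigeonhole: distinct touched vertices outside ts touch through distinct edges of E.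
  touched-≤ : ∀ {E ts xs} → Unique xs → All (_∉ ts) xs → All (Touches E ts) xs →
    length xs ≤ length E
  touched-≤ {E} {ts} {xs} uniq out touch = ≮⇒≥ λ E<xs →
    let (i , j , i<j , same) = pigeonhole E<xs edgeOf
        joined-j = subst (λ f → JoinedTo ts (lookup xs j) (lookup E f)) (≡.sym same) (joined j)
    in lookup-distinct uniq i<j
         (joinedTo-unique (All.lookup out (∈-lookup i)) (All.lookup out (∈-lookup j))
           (joined i) joined-j)
    where
    edge : ∀ i → ∃[ e ] e ∈ E × JoinedTo ts (lookup xs i) e
    edge i = touching-edge (All.lookup touch (∈-lookup i))

    edgeOf : Fin (length xs) → Fin (length E)
    edgeOf i = index (proj₁ (proj₂ (edge i)))

    joined : ∀ i → JoinedTo ts (lookup xs i) (lookup E (edgeOf i))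
    joined i = subst (JoinedTo ts (lookup xs i)) (lookup-index (proj₁ (proj₂ (edge i))))
                     (proj₂ (proj₂ (edge i)))

  module _ (_≟ₐ_ : DecidableEquality A) where

    open DecMembership (≡-dec _≟ₐ_ _≟ₐ_) using () renaming (_∈?_ to _∈ₑ?_)

    touches? : ∀ E ts → Decidable (Touches E ts)
    touches? E ts x = any? (λ t → ((x , t) ∈ₑ? E) ⊎-dec ((t , x) ∈ₑ? E)) ts

    some-untouched : ∀ {E ts xs} → Unique xs → All (_∉ ts) xs → length E < length xs →
      ∃[ x ] x ∈ xs × ¬ Touches E ts x
    some-untouched {E} {ts} {xs} uniq out E<xs with all? (touches? E ts) xs
    ... | yes touch  = ⊥-elim (<⇒≱ E<xs (touched-≤ uniq out touch))
    ... | no ¬touch = find (¬All⇒Any¬ (touches? E ts) xs ¬touch)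

open Touching

fromList : ∀ {n} → List (Fin n) → Subset n
fromList = foldr (λ x p → ⁅ x ⁆ ∪ p) ⊥

∈-fromList : ∀ {n} (xs : List (Fin n)) {y} → y ∈ₛ fromList xs ⇔ y ∈ xs
∈-fromList _ = mk⇔ to′ from′
  where
  to′ : ∀ {n} {xs : List (Fin n)} {y} → y ∈ₛ fromList xs → y ∈ xs
  to′ {xs = []} y∈ = contradiction y∈ ∉⊥
  to′ {xs = x ∷ xs} y∈ with x∈p∪q⁻ ⁅ x ⁆ (fromList xs) y∈
  ... | inj₁ y∈⁅x⁆ = here (x∈⁅y⁆⇒x≡y x y∈⁅x⁆)
  ... | inj₂ y∈xs  = there (to′ y∈xs)

  from′ : ∀ {n} {xs : List (Fin n)} {y} → y ∈ xs → y ∈ₛ fromList xs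
  from′ {xs = x ∷ _} (here refl) = x∈p∪q⁺ (inj₁ (x∈⁅x⁆ x))
  from′ (there y∈) = x∈p∪q⁺ (inj₂ (from′ y∈))

x∉p⇒∣⁅x⁆∪p∣≡1+∣p∣ : ∀ {n} {x : Fin n} {p} → x ∉ₛ p → ∣ ⁅ x ⁆ ∪ p ∣ ≡ suc ∣ p ∣
x∉p⇒∣⁅x⁆∪p∣≡1+∣p∣ {x = zero}  {outside ∷ p} _   = cong (suc ∘ ∣_∣) (∪-identityˡ p)
x∉p⇒∣⁅x⁆∪p∣≡1+∣p∣ {x = zero}  {inside ∷ p}  x∉p = contradiction here x∉p
x∉p⇒∣⁅x⁆∪p∣≡1+∣p∣ {x = suc x} {outside ∷ p} x∉p = x∉p⇒∣⁅x⁆∪p∣≡1+∣p∣ (x∉p ∘ there)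
x∉p⇒∣⁅x⁆∪p∣≡1+∣p∣ {x = suc x} {inside ∷ p}  x∉p = cong suc (x∉p⇒∣⁅x⁆∪p∣≡1+∣p∣ (x∉p ∘ there))

∣fromList∣≡length : ∀ {n} {xs : List (Fin n)} → Unique xs → ∣ fromList xs ∣ ≡ length xs
∣fromList∣≡length {n} {[]} [] = ∣⊥∣≡0 n
∣fromList∣≡length {xs = x ∷ xs} (x≢ ∷ uniq) =
  trans (x∉p⇒∣⁅x⁆∪p∣≡1+∣p∣ (λ x∈ → All.lookup x≢ (to (∈-fromList xs) x∈) refl))
        (cong suc (∣fromList∣≡length uniq))

avoid-two : ∀ {A : Set} → DecidableEquality A → ∀ {a b c : A} → a ≢ b → a ≢ c → b ≢ c →
  ∀ x y → ∃[ s ] s ∈ (a ∷ b ∷ c ∷ []) × s ≢ x × s ≢ y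
avoid-two _≟ₐ_ {a} {b} {c} a≢b a≢c b≢c x y with (a ≟ₐ x) ⊎-dec (a ≟ₐ y) | (b ≟ₐ x) ⊎-dec (b ≟ₐ y)
... | no a∉    | _        = a , here refl , a∉ ∘ inj₁ , a∉ ∘ inj₂
... | yes _    | no b∉    = b , there (here refl) , b∉ ∘ inj₁ , b∉ ∘ inj₂
... | yes a∈xy | yes b∈xy =
  c , there (there (here refl)) , c∉xy a∈xy b∈xy ∘ inj₁ , c∉xy a∈xy b∈xy ∘ inj₂
  where
  c∉xy : (a ≡ x ⊎ a ≡ y) → (b ≡ x ⊎ b ≡ y) → ¬ (c ≡ x ⊎ c ≡ y)
  c∉xy (inj₁ refl) (inj₁ refl) _           = a≢b refl
  c∉xy (inj₂ refl) (inj₂ refl) _           = a≢b refl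
  c∉xy (inj₁ refl) (inj₂ refl) (inj₁ refl) = a≢c refl
  c∉xy (inj₁ refl) (inj₂ refl) (inj₂ refl) = b≢c refl
  c∉xy (inj₂ refl) (inj₁ refl) (inj₁ refl) = b≢c refl
  c∉xy (inj₂ refl) (inj₁ refl) (inj₂ refl) = a≢c refl

adj⇒≢ : ∀ {V} (G : Graph V) {x y} → Adj G x y → x ≢ y
adj⇒≢ G xy refl = irrefl G xy

deleteEdges-sym : ∀ {V} (G : Graph V) (L : List (V × V)) {x y} →
  DeleteEdges G L x y → DeleteEdges G L y x
deleteEdges-sym G L (xy , xy∉ , yx∉) = sym G xy , yx∉ , xy∉

isInducedPaw-cong : ∀ {W V : Set} {S : W → W → Set} {R : V → V → Set} (f : W → V) →
  (∀ {x y} → S x y ⇔ R (f x) (f y)) →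
  ∀ {a b c d} → IsInducedPaw S a b c d ⇔ IsInducedPaw R (f a) (f b) (f c) (f d)
isInducedPaw-cong f S⇔R = mk⇔
  (λ (ab , bc , ac , cd , ¬ad , ¬bd) →
     to S⇔R ab , to S⇔R bc , to S⇔R ac , to S⇔R cd , ¬ad ∘ from S⇔R , ¬bd ∘ from S⇔R)
  (λ (ab , bc , ac , cd , ¬ad , ¬bd) →
     from S⇔R ab , from S⇔R bc , from S⇔R ac , from S⇔R cd , ¬ad ∘ to S⇔R , ¬bd ∘ to S⇔R)

module _ {V : Set} {R : V → V → Set} (R-sym : ∀ {x y} → R x y → R y x) where

  isInducedPaw-swap : ∀ {a b c d} → IsInducedPaw R a b c d → IsInducedPaw R b a c d
  isInducedPaw-swap (ab , bc , ac , cd , ¬ad , ¬bd) = R-sym ab , ac , bc , cd , ¬bd , ¬ad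

  module _ {Good : V → Set} (good? : Decidable Good) where

    -- Double negation suffices because paw-freeness is a negative statement.
    Exchangeable : (V → Set) → V → Set
    Exchangeable P x = ¬ Good x → P x → ¬ ¬ (∃[ y ] Good y × P y)

    private
      replace : ∀ {P : V → Set} {x} → (∀ {y} → Good y → ¬ P y) → Exchangeable P x → ¬ P x
      replace {x = x} good⇒¬P exchange p with good? x
      ... | yes g = good⇒¬P g p
      ... | no ¬g = exchange ¬g p λ (y , g , q) → good⇒¬P g q

    pawFree-by-exchange :
      (∀ {a b c d} → Good a → Good b → Good c → Good d → ¬ IsInducedPaw R a b c d) →
      (∀ {a b c d} → Exchangeable (λ a → IsInducedPaw R a b c d) a) →
      (∀ {a b c d} → Exchangeable (λ c → IsInducedPaw R a b c d) c) →
      (∀ {a b c d} → Exchangeable (λ d → IsInducedPaw R a b c d) d) →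
      PawFree R
    pawFree-by-exchange good⇒¬paw exchange-a exchange-c exchange-d a b c d =
      replace {P = λ d → IsInducedPaw R a b c d} good-d⇒¬paw exchange-d
      where
      exchange-b : ∀ {a b c d} → Exchangeable (λ b → IsInducedPaw R a b c d) b
      exchange-b ¬gb p = ¬¬-map (λ (b' , gb' , p') → b' , gb' , isInducedPaw-swap p')
                                (exchange-a ¬gb (isInducedPaw-swap p))

      good-acd⇒¬paw : ∀ {a b c d} → Good a → Good c → Good d → ¬ IsInducedPaw R a b c d
      good-acd⇒¬paw {a} {c = c} {d} ga gc gd =
        replace {P = λ b → IsInducedPaw R a b c d} (λ gb → good⇒¬paw ga gb gc gd) exchange-b

      good-cd⇒¬paw : ∀ {a b c d} → Good c → Good d → ¬ IsInducedPaw R a b c d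
      good-cd⇒¬paw {b = b} {c} {d} gc gd =
        replace {P = λ a → IsInducedPaw R a b c d} (λ ga → good-acd⇒¬paw ga gc gd) exchange-a

      good-d⇒¬paw : ∀ {d} → Good d → ¬ IsInducedPaw R a b c d
      good-d⇒¬paw {d} gd =
        replace {P = λ c → IsInducedPaw R a b c d} (λ gc → good-cd⇒¬paw gc gd) exchange-c

module InducedSubgraph {n : ℕ} (G : Graph (Fin n)) (K : Subset n) where

  private
    V* : Set
    V* = Σ (Fin n) (_∈ₛ K)

  forget : V* × V* → Fin n × Fin n
  forget (x , y) = proj₁ x , proj₁ y

  forget-injective : ∀ {e e'} → forget e ≡ forget e' → e ≡ e'
  forget-injective {(_ , p) , (_ , q)} {(_ , p') , (_ , q')} refl
    rewrite []=-irrelevant p p' | []=-irrelevant q q' = refl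

  restrict : List (Fin n × Fin n) → List (V* × V*)
  restrict [] = []
  restrict ((x , y) ∷ l) with x ∈? K ×-dec y ∈? K
  ... | yes (x∈K , y∈K) = ((x , x∈K) , (y , y∈K)) ∷ restrict l
  ... | no _            = restrict l

  ∈-restrict : ∀ l {e} → e ∈ restrict l ⇔ forget e ∈ l
  ∈-restrict l = mk⇔ (sound l) (complete l)
    where
    sound : ∀ l {e} → e ∈ restrict l → forget e ∈ l
    sound ((x , y) ∷ l) e∈ with x ∈? K ×-dec y ∈? K | e∈
    ... | yes _ | here refl = here refl
    ... | yes _ | there e∈l = there (sound l e∈l)
    ... | no _  | e∈l       = there (sound l e∈l)

    complete : ∀ l {e} → forget e ∈ l → e ∈ restrict l
    complete ((x , y) ∷ l) {(_ , p) , (_ , q)} e∈ with x ∈? K ×-dec y ∈? K | e∈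
    ... | yes _ | here eq   = here (forget-injective eq)
    ... | yes _ | there e∈l = there (complete l e∈l)
    ... | no ¬k | here refl = contradiction (p , q) ¬k
    ... | no _  | there e∈l = complete l e∈l

  restrict-length : ∀ l → length (restrict l) ≤ length l
  restrict-length [] = z≤n
  restrict-length ((x , y) ∷ l) with x ∈? K ×-dec y ∈? K
  ... | yes _ = s≤s (restrict-length l)
  ... | no _  = m≤n⇒m≤1+n (restrict-length l)

  restrict-adjacent : ∀ {l} → All (λ e → Adj G (proj₁ e) (proj₂ e)) l →
    All (λ e → Adj (Induced G K) (proj₁ e) (proj₂ e)) (restrict l)
  restrict-adjacent [] = []
  restrict-adjacent {(x , y) ∷ l} (xy ∷ adj) with x ∈? K ×-dec y ∈? K
  ... | yes _ = xy ∷ restrict-adjacent adj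
  ... | no _  = restrict-adjacent adj

  deleteEdges-transfer : ∀ (l* : List (V* × V*)) l → (∀ {e} → e ∈ l* ⇔ forget e ∈ l) →
    ∀ {x y} → DeleteEdges (Induced G K) l* x y ⇔ DeleteEdges G l (proj₁ x) (proj₁ y)
  deleteEdges-transfer l* l ∈⇔ = mk⇔
    (λ (xy , xy∉ , yx∉) → xy , xy∉ ∘ from ∈⇔ , yx∉ ∘ from ∈⇔)
    (λ (xy , xy∉ , yx∉) → xy , xy∉ ∘ to ∈⇔ , yx∉ ∘ to ∈⇔)

  isInducedPaw-transfer : ∀ (l* : List (V* × V*)) l → (∀ {e} → e ∈ l* ⇔ forget e ∈ l) →
    ∀ {a b c d} → IsInducedPaw (DeleteEdges (Induced G K) l*) a b c d
                ⇔ IsInducedPaw (DeleteEdges G l) (proj₁ a) (proj₁ b) (proj₁ c) (proj₁ d)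
  isInducedPaw-transfer l* l ∈⇔ =
    isInducedPaw-cong {S = DeleteEdges (Induced G K) l*} proj₁ (deleteEdges-transfer l* l ∈⇔)

  restrict-solution : ∀ {k} → YesInstance G k → YesInstance (Induced G K) k
  restrict-solution (l , adj , size , pawFree) =
    restrict l , restrict-adjacent adj , ≤-trans (restrict-length l) size ,
    λ a b c d → pawFree _ _ _ _ ∘ to (isInducedPaw-transfer (restrict l) l (∈-restrict l))

  record InsideSolution (k : ℕ) : Set where
    field
      edges          : List (Fin n × Fin n)
      adjacent       : All (λ e → Adj G (proj₁ e) (proj₂ e)) edges
      size≤          : length edges ≤ k
      edges-inside   : All (λ e → proj₁ e ∈ₛ K × proj₂ e ∈ₛ K) edges
      pawFree-inside : ∀ {a b c d} → a ∈ₛ K → b ∈ₛ K → c ∈ₛ K → d ∈ₛ K →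
                       ¬ IsInducedPaw (DeleteEdges G edges) a b c d

  lift-solution : ∀ {k} → YesInstance (Induced G K) k → InsideSolution k
  lift-solution {k} (l* , adj , size , pawFree) = record
    { edges          = map forget l*
    ; adjacent       = All-map⁺ adj
    ; size≤          = subst (_≤ k) (≡.sym (length-map forget l*)) size
    ; edges-inside   = All-map⁺ (All.tabulate λ {e} _ → proj₂ (proj₁ e) , proj₂ (proj₂ e))
    ; pawFree-inside = λ a∈ b∈ c∈ d∈ → pawFree (_ , a∈) (_ , b∈) (_ , c∈) (_ , d∈) ∘
        from (isInducedPaw-transfer l* (map forget l*) ∈-map-forget)
    }
    where
    ∈-map-forget : ∀ {e} → e ∈ l* ⇔ forget e ∈ map forget l*
    ∈-map-forget = mk⇔ (∈-map⁺ forget) λ e∈ →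
      let (e' , e'∈ , same) = ∈-map⁻ forget e∈ in subst (_∈ l*) (forget-injective (≡.sym same)) e'∈

module Reduction {n : ℕ} (G : Graph (Fin n)) (F : List (Setting.Paw G)) where

  open Setting G using (V; Paw; paw; module Paw; PawVertex)
  open Setting.Family G F

  _~_ : V → V → Set
  x ~ y = Adj G x y

  pawVertex? : ∀ P → Decidable (PawVertex P)
  pawVertex? (paw a b c d _) x = x ≟ a ⊎-dec x ≟ b ⊎-dec x ≟ c ⊎-dec x ≟ d

  inM? : Decidable InM
  inM? x = ∃-Fin? λ i → pawVertex? (lookup F i) x

  triangle⇒pawVertex : ∀ P {s} → s ∈ (Paw.a P ∷ Paw.b P ∷ Paw.c P ∷ []) → PawVertex P s
  triangle⇒pawVertex _ (here s≡a)                 = inj₁ s≡a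
  triangle⇒pawVertex _ (there (here s≡b))         = inj₂ (inj₁ s≡b)
  triangle⇒pawVertex _ (there (there (here s≡c))) = inj₂ (inj₂ (inj₁ s≡c))

  M-avoiding : ∀ {m} → InM m → ∀ x y → ∃[ s ] InM s × s ≢ x × s ≢ y
  M-avoiding (i , _) x y =
    let P = lookup F i
        (ab , bc , ac , _) = Paw.isPaw P
        (s , s∈ , s≢x , s≢y) = avoid-two _≟_ (adj⇒≢ G ab) (adj⇒≢ G ac) (adj⇒≢ G bc) x y
    in s , (i , triangle⇒pawVertex P s∈) , s≢x , s≢y

  MTriple : List V → Set
  MTriple ts = Unique ts × length ts ≡ 3 × All InM ts

  mTriple : ∀ {p q r} → p ≢ q → p ≢ r → q ≢ r → InM p → InM q → InM r →
    MTriple (p ∷ q ∷ r ∷ [])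
  mTriple p≢q p≢r q≢r mp mq mr =
    ((p≢q ∷ p≢r ∷ []) ∷ (q≢r ∷ []) ∷ [] ∷ []) , refl , (mp ∷ mq ∷ mr ∷ [])

  M-triple-around : ∀ {x y z} → InM x → x ≢ y → x ≢ z → y ≢ z →
    ∃[ ts ] MTriple ts × x ∈ ts × (InM y → y ∈ ts) × (InM z → z ∈ ts)
  M-triple-around {x} {y} {z} mx x≢y x≢z y≢z with inM? y | inM? z
  ... | yes my | yes mz =
    _ , mTriple x≢y x≢z y≢z mx my mz , here refl ,
    (λ _ → there (here refl)) , (λ _ → there (there (here refl)))
  ... | yes my | no ¬mz =
    let (s , ms , s≢x , s≢y) = M-avoiding mx x y in
    _ , mTriple x≢y (≢-sym s≢x) (≢-sym s≢y) mx my ms , here refl ,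
    (λ _ → there (here refl)) , ⊥-elim ∘ ¬mz
  ... | no ¬my | yes mz =
    let (s , ms , s≢x , s≢z) = M-avoiding mx x z in
    _ , mTriple x≢z (≢-sym s≢x) (≢-sym s≢z) mx mz ms , here refl ,
    ⊥-elim ∘ ¬my , (λ _ → there (here refl))
  ... | no ¬my | no ¬mz =
    let (s , ms , s≢x , _) = M-avoiding mx x x
        (t , mt , t≢x , t≢s) = M-avoiding mx x s in
    _ , mTriple (≢-sym s≢x) (≢-sym t≢x) (≢-sym t≢s) mx ms mt , here refl ,
    ⊥-elim ∘ ¬my , ⊥-elim ∘ ¬mz

  reach-adj : ∀ {x y} → ¬ InM x → x ~ y → ¬ InM y → Reach x y
  reach-adj ¬mx xy ¬my = step ¬mx xy (here ¬my)

  reach-end : ∀ {x y} → Reach x y → ¬ InM y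
  reach-end (here ¬my)    = ¬my
  reach-end (step _ _ xy) = reach-end xy

  InU-adj : ∀ {u v} → InU u → u ~ v → ¬ InM v → InU v
  InU-adj (¬mu , triangle-free , ¬typeI) uv ¬mv =
    ¬mv ,
    (λ (p , q , r , vp , vq , vr , pqr) →
       triangle-free (p , q , r , step ¬mu uv vp , step ¬mu uv vq , step ¬mu uv vr , pqr)) ,
    (λ (m , p , q , mm , vp , vq , mpq) →
       ¬typeI (m , p , q , mm , step ¬mu uv vp , step ¬mu uv vq , mpq))

  InU-triangle : ∀ {u v w} → InU u → u ~ v → u ~ w → v ~ w → InM v × InM w
  InU-triangle {u} {v} {w} (¬mu , triangle-free , ¬typeI) uv uw vw with inM? v | inM? w
  ... | yes mv | yes mw = mv , mw
  ... | no ¬mv | no ¬mw =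
    ⊥-elim (triangle-free
      (u , v , w , here ¬mu , reach-adj ¬mu uv ¬mv , reach-adj ¬mu uw ¬mw , uv , vw , uw))
  ... | no ¬mv | yes mw =
    ⊥-elim (¬typeI (w , u , v , mw , here ¬mu , reach-adj ¬mu uv ¬mv , uv , sym G uw , sym G vw))
  ... | yes mv | no ¬mw =
    ⊥-elim (¬typeI (v , u , w , mv , here ¬mu , reach-adj ¬mu uw ¬mw , uw , sym G uv , vw))

  InU-no-common-neighbour : ∀ {u m x} → InU u → InM m → m ~ u → m ~ x → ¬ InM x → ¬ u ~ x
  InU-no-common-neighbour (¬mu , _ , ¬typeI) mm mu mx ¬mx ux =
    ¬typeI (_ , _ , _ , mm , here ¬mu , reach-adj ¬mu ux ¬mx , ux , mu , mx)

  eligibleII : ∀ {x y a b} → InU x → x ~ y → ¬ InM y → x ~ a → x ~ b → a ~ b → EligibleII x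
  eligibleII x∈U xy ¬my xa xb ab =
    let (ma , mb) = InU-triangle x∈U xa xb ab
    in x∈U , (_ , ≢-sym (adj⇒≢ G xy) , reach-adj (proj₁ x∈U) xy ¬my) ,
       _ , _ , ma , mb , xa , xb , ab

  neighboursIn : V → List V → Subset n
  neighboursIn u ts = fromList (filter (adj? G u) ts)

  ruleIPair-fromList : ∀ {u ts} → MTriple ts → RuleIPair (fromList ts) (neighboursIn u ts)
  ruleIPair-fromList {u} {ts} (uniq , three , all-M) =
    trans (∣fromList∣≡length uniq) three ,
    (λ y y∈S → All.lookup all-M (to (∈-fromList ts) y∈S)) ,
    from (∈-fromList ts) ∘ proj₁ ∘ ∈-filter⁻ (adj? G u) ∘ to (∈-fromList (filter (adj? G u) ts))

  classI-own : ∀ {u ts} → InU u → ClassI (fromList ts) (neighboursIn u ts) u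
  classI-own {u} {ts} u∈U = u∈U , λ y → mk⇔
    (λ (uy , y∈S) → from (∈-fromList uts) (∈-filter⁺ (adj? G u) (to (∈-fromList ts) y∈S) uy))
    (λ y∈S' → let (y∈ , uy) = ∈-filter⁻ (adj? G u) (to (∈-fromList uts) y∈S')
              in uy , from (∈-fromList ts) y∈)
    where
    uts : List V
    uts = filter (adj? G u) ts

  classI-same-adj : ∀ {S S' u x y} → ClassI S S' u → ClassI S S' x → y ∈ₛ S → u ~ y ⇔ x ~ y
  classI-same-adj {y = y} (_ , u-class) (_ , x-class) y∈S = mk⇔
    (λ uy → proj₁ (from (x-class y) (to (u-class y) (uy , y∈S))))
    (λ xy → proj₁ (from (u-class y) (to (x-class y) (xy , y∈S))))

  module _ {k : ℕ} (mk : Marking k) (K : Subset n)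
           (K-spec : ∀ x → x ∈ₛ K ⇔ (InU x → Marked mk x))
           (sol : InducedSubgraph.InsideSolution G K k) where

    open InducedSubgraph.InsideSolution sol
    open Marking mk

    Kept : V → V → Set
    Kept = DeleteEdges G edges

    marked⇒inside : ∀ {x} → Marked mk x → x ∈ₛ K
    marked⇒inside {x} marked = from (K-spec x) λ _ → marked

    outside⇒unmarked : ∀ {x} → x ∉ₛ K → ¬ Marked mk x
    outside⇒unmarked x∉K = x∉K ∘ marked⇒inside

    outside⇒¬¬InU : ∀ {x} → x ∉ₛ K → ¬ ¬ InU x
    outside⇒¬¬InU {x} x∉K ¬u = x∉K (from (K-spec x) (⊥-elim ∘ ¬u))

    outside-kept : ∀ {u y} → u ∉ₛ K → u ~ y → Kept u y
    outside-kept u∉K uy =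
      uy , u∉K ∘ proj₁ ∘ All.lookup edges-inside , u∉K ∘ proj₂ ∘ All.lookup edges-inside

    -- A choice missing a member of X has k + 1 elements, more than the deleted edges can touch.
    choice-untouched : ∀ {X xs ts u} → MarkChoice k X xs → X u → u ∉ xs → (∀ {x} → X x → x ∉ ts) →
      ∃[ x ] x ∈ xs × X x × ¬ Touches edges ts x
    choice-untouched {xs = xs} (uniq , all-X , size) Xu u∉ X⇒∉ts with size
    ... | inj₂ complete = contradiction (complete _ Xu) u∉
    ... | inj₁ full =
      let (x , x∈ , ¬touch) = some-untouched _≟_ uniq (All.map X⇒∉ts all-X) edges<xs
      in x , x∈ , All.lookup all-X x∈ , ¬touch
      where
      edges<xs : length edges < length xs
      edges<xs = subst (length edges <_) (≡.sym full) (s≤s size≤)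

    record Substitute (u : V) (ts : List V) : Set where
      field
        vertex   : V
        vertex∈U : InU vertex
        vertex∈K : vertex ∈ₛ K
        keeps    : ∀ {y} → y ∈ ts → u ~ y → Kept vertex y
        reflects : ∀ {y} → y ∈ ts → vertex ~ y → u ~ y

    ruleI-substitute : ∀ {u ts} → InU u → ¬ Marked mk u → MTriple ts → Substitute u ts
    ruleI-substitute {u} {ts} u∈U ¬marked triple@(_ , _ , all-M)
      with choice-untouched (chooseI-ok _ _ (ruleIPair-fromList {u} {ts} triple))
             (classI-own {u} {ts} u∈U)
             (λ u∈ → ¬marked (inj₁ (_ , _ , ruleIPair-fromList {u} {ts} triple , u∈)))
             (λ ((¬m , _) , _) x∈ts → ¬m (All.lookup all-M x∈ts))
    ... | u' , u'∈ , class-u' , ¬touch = record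
      { vertex   = u'
      ; vertex∈U = proj₁ class-u'
      ; vertex∈K = marked⇒inside (inj₁ (_ , _ , ruleIPair-fromList {u} {ts} triple , u'∈))
      ; keeps    = λ y∈ uy → to (same-adj y∈) uy , ¬touches⇒∉ ¬touch y∈
      ; reflects = λ y∈ → from (same-adj y∈)
      }
      where
      same-adj : ∀ {y} → y ∈ ts → u ~ y ⇔ u' ~ y
      same-adj y∈ = classI-same-adj (classI-own {u} {ts} u∈U) class-u' (from (∈-fromList ts) y∈)

    substitute-nonadj : ∀ {u ts m x} (s : Substitute u ts) → InM m → m ∈ ts → u ~ m → m ~ x →
      (InM x → x ∈ ts) → ¬ u ~ x → ¬ Substitute.vertex s ~ x
    substitute-nonadj {x = x} s mm m∈ um mx x∈ ¬ux u'x with inM? x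
    ... | yes mx' = ¬ux (Substitute.reflects s (x∈ mx') u'x)
    ... | no ¬mx' = InU-no-common-neighbour (Substitute.vertex∈U s) mm
                      (sym G (proj₁ (Substitute.keeps s m∈ um))) mx ¬mx' u'x

    ruleII-substitute : ∀ {c u} → EligibleII c → ¬ Marked mk u → NbrInComp c u →
      ∃[ u' ] u' ∈ₛ K × NbrInComp c u' × Kept c u'
    ruleII-substitute {c} eligible ¬marked cu =
      let (u' , u'∈ , cu' , ¬touch) = choice-untouched {ts = c ∷ []} (chooseII-ok c eligible) cu
            (λ u∈ → ¬marked (inj₂ (inj₂ (c , eligible , u∈))))
            (λ { (cc , _) (here refl) → irrefl G cc ; _ (there ()) })
          (u'c∉ , cu'∉) = ¬touches⇒∉ ¬touch (here refl)
      in u' , marked⇒inside (inj₂ (inj₂ (c , eligible , u'∈))) , cu' , proj₁ cu' , cu'∉ , u'c∉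

    KeptPaw : V → V → V → V → Set
    KeptPaw = IsInducedPaw Kept

    exchange-pendant-off-M : ∀ {a b c u} → u ∉ₛ K → InU u → ¬ InM c → KeptPaw a b c u →
      ∃[ u' ] u' ∈ₛ K × KeptPaw a b c u'
    exchange-pendant-off-M {a} {b} {c} {u} u∉K u∈U ¬mc
      (ab@(a~b , _) , bc@(b~c , _) , ac@(a~c , _) , (c~u , _) , _ , _)
      with InU-adj u∈U (sym G c~u) ¬mc
    ... | c∈U
      with ruleII-substitute (eligibleII c∈U c~u (proj₁ u∈U) (sym G a~c) (sym G b~c) a~b)
             (outside⇒unmarked u∉K) (c~u , reach-adj ¬mc c~u (proj₁ u∈U))
    ... | u' , u'∈K , (c~u' , reach-u') , kept-cu' =
      u' , u'∈K , ab , bc , ac , kept-cu' , ¬kept (proj₁ ma×mb) a~c , ¬kept (proj₂ ma×mb) b~c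
      where
      ma×mb : InM a × InM b
      ma×mb = InU-triangle c∈U (sym G a~c) (sym G b~c) a~b

      ¬kept : ∀ {x} → InM x → x ~ c → ¬ Kept x u'
      ¬kept mx x~c (x~u' , _) = InU-no-common-neighbour c∈U mx x~c x~u' (reach-end reach-u') c~u'

    exchange-pendant-in-M : ∀ {a b c u} → u ∉ₛ K → InU u → InM c → KeptPaw a b c u →
      ∃[ u' ] u' ∈ₛ K × KeptPaw a b c u'
    exchange-pendant-in-M {a} {b} {c} {u} u∉K u∈U mc
      (ab@(a~b , _) , bc@(b~c , _) , ac@(a~c , _) , (c~u , _) , ¬au , ¬bu)
      with M-triple-around mc (≢-sym (adj⇒≢ G a~c)) (≢-sym (adj⇒≢ G b~c)) (adj⇒≢ G a~b)
    ... | ts , triple , c∈ , a∈ , b∈ =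
      vertex , vertex∈K , ab , bc , ac , deleteEdges-sym G edges (keeps c∈ (sym G c~u)) ,
      ¬kept a~c a∈ ¬au , ¬kept b~c b∈ ¬bu
      where
      s : Substitute u ts
      s = ruleI-substitute u∈U (outside⇒unmarked u∉K) triple
      open Substitute s

      ¬kept : ∀ {x} → x ~ c → (InM x → x ∈ ts) → ¬ Kept x u → ¬ Kept x vertex
      ¬kept x~c x∈ ¬xu (x~u' , _) = substitute-nonadj s mc c∈ (sym G c~u) (sym G x~c) x∈
        (¬xu ∘ deleteEdges-sym G edges ∘ outside-kept u∉K) (sym G x~u')

    exchange-pendant : ∀ {a b c u} → u ∉ₛ K → InU u → KeptPaw a b c u →
      ∃[ u' ] u' ∈ₛ K × KeptPaw a b c u'
    exchange-pendant {c = c} u∉K u∈U p with inM? c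
    ... | yes mc = exchange-pendant-in-M u∉K u∈U mc p
    ... | no ¬mc = exchange-pendant-off-M u∉K u∈U ¬mc p

    exchange-hub : ∀ {a b u d} → u ∉ₛ K → InU u → KeptPaw a b u d →
      ∃[ u' ] u' ∈ₛ K × KeptPaw a b u' d
    exchange-hub {a} {b} {u} {d} u∉K u∈U
      (ab@(a~b , _) , (b~u , _) , (a~u , _) , (u~d , _) , ¬ad , ¬bd) with inM? d
    ... | no ¬md =
      ⊥-elim (outside⇒unmarked u∉K
        (inj₂ (inj₁ (eligibleII u∈U u~d ¬md (sym G a~u) (sym G b~u) a~b))))
    ... | yes md =
      vertex , vertex∈K , ab ,
      deleteEdges-sym G edges (keeps (there (here refl)) (sym G b~u)) ,
      deleteEdges-sym G edges (keeps (here refl) (sym G a~u)) ,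
      keeps (there (there (here refl))) u~d , ¬ad , ¬bd
      where
      ma×mb : InM a × InM b
      ma×mb = InU-triangle u∈U (sym G a~u) (sym G b~u) a~b

      a≢d : a ≢ d
      a≢d a≡d = ¬bd (subst (Kept b) a≡d (deleteEdges-sym G edges ab))

      b≢d : b ≢ d
      b≢d b≡d = ¬ad (subst (Kept a) b≡d ab)

      open Substitute (ruleI-substitute u∈U (outside⇒unmarked u∉K)
                         (mTriple (adj⇒≢ G a~b) a≢d b≢d (proj₁ ma×mb) (proj₂ ma×mb) md))

    exchange-rim : ∀ {u b c d} → u ∉ₛ K → InU u → KeptPaw u b c d →
      ∃[ u' ] u' ∈ₛ K × KeptPaw u' b c d
    exchange-rim {u} {b} {c} {d} u∉K u∈U
      (ub@(u~b , _) , bc@(b~c , _) , (u~c , _) , cd@(c~d , _) , ¬ud , ¬bd)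
      with InU-triangle u∈U u~b u~c b~c
    ... | mb , mc
      with M-triple-around mb (adj⇒≢ G b~c) (λ b≡d → ¬ud (subst (Kept u) b≡d ub)) (adj⇒≢ G c~d)
    ... | ts , triple , b∈ , c∈ , d∈ =
      vertex , vertex∈K , keeps b∈ u~b , bc , keeps (c∈ mc) u~c , cd ,
      substitute-nonadj s mc (c∈ mc) u~c c~d d∈ (¬ud ∘ outside-kept u∉K) ∘ proj₁ , ¬bd
      where
      s : Substitute u ts
      s = ruleI-substitute u∈U (outside⇒unmarked u∉K) triple
      open Substitute s

    kept-pawFree : PawFree Kept
    kept-pawFree = pawFree-by-exchange (deleteEdges-sym G edges) (_∈? K) pawFree-inside
      (λ u∉K p → ¬¬-map (λ u∈U → exchange-rim u∉K u∈U p) (outside⇒¬¬InU u∉K))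
      (λ u∉K p → ¬¬-map (λ u∈U → exchange-hub u∉K u∈U p) (outside⇒¬¬InU u∉K))
      (λ u∉K p → ¬¬-map (λ u∈U → exchange-pendant u∉K u∈U p) (outside⇒¬¬InU u∉K))

    yes-instance : YesInstance G k
    yes-instance = edges , adjacent , size≤ , kept-pawFree

lemma27 : ∀ {n : ℕ} (G : Graph (Fin n)) (k : ℕ) (F : List (Setting.Paw G)) →
    Setting.EdgeDisjoint G F → Setting.Maximal G F →
    (mk : Setting.Family.Marking G F k) →
    (K : Subset n) →
    (∀ x → x ∈ₛ K ⇔ (Setting.Family.InU G F x → Setting.Family.Marked G F mk x)) →
    YesInstance G k ⇔ YesInstance (Induced G K) k
lemma27 G k F _ _ mk K K-spec =
  mk⇔ restrict-solution (Reduction.yes-instance G F mk K K-spec ∘ lift-solution)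
  where open InducedSubgraph G K
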